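{- Let $k\ge 1$ and let $G_1,G_2$ be vertex-disjoint finite simple graphs, with cliques $X_1\subseteq V(G_1)$, $X_2\subseteq V(G_2)$, $|X_1|=|X_2|=k$. Let $G$ be a $k$-clique-sum of $G_1$ and $G_2$ (obtained by identifying $X_1$ with $X_2$ via a bijection and possibly deleting some edges of the identified clique), and let $K=\{v_1,\dots,v_k\}$ be the common (identified) clique. For $i=1,2$ let $G_i'=G_i\cap G$, i.e. the subgraph of $G$ with vertex set $V(G_i)$ and edge set consisting of those edges of $G_i$ that remain in $G$. Let $\ell$ be an integer. Suppose that $G_1'$ has an AT-orientation $D_1'$ with $\Delta^+(D_1')\le \ell$, and that $G_2$ has an AT-orientation $D_2$ with $\Delta^+(D_2)\le \ell$ and $d^+_{D_2}(v_i)=i-1$ for $i=1,\dots,k$. Then $G$ has an AT-orientation $D$ such that $\Delta^+(D)\le \ell$ and $d_D^+(v)=d_{D_1'}^+(v)$ for every $v\in V(G_1)$.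
   Context: A clique of a graph is a nonempty vertex set inducing a complete subgraph. For an orientation $D$ of a graph, $d_D^+(v)$ denotes the out-degree of $v$ and $\Delta^+(D)$ the maximum out-degree. An Eulerian subdigraph of $D$ is a spanning subdigraph $H$ with $d_H^+(v)=d_H^-(v)$ for all vertices $v$. $EE(D)$ (resp. $OE(D)$) is the set of Eulerian subdigraphs of $D$ with an even (resp. odd) number of arcs. An orientation $D$ is an AT-orientation if $|EE(D)|\ne|OE(D)|$. -}

module Defs where

open import Data.Bool using (Bool; true; false; _∧_; _∨_; not)
open import Data.Nat using (ℕ; zero; suc; _≡ᵇ_)
open import Data.Fin using (Fin; toℕ)
open import Data.List using (List; []; _∷_; map; _++_; length; filterᵇ; cartesianProduct; allFin)
open import Data.Bool.ListAction using (and)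
open import Data.Product using (_×_; _,_; proj₁; proj₂)
open import Data.Sum using (_⊎_)
open import Relation.Binary.PropositionalEquality using (_≡_; _≢_)

record SimpleGraph (n : ℕ) : Set where
  field
    adj    : Fin n → Fin n → Bool
    sym    : ∀ u v → adj u v ≡ adj v u
    irrefl : ∀ v → adj v v ≡ false
open SimpleGraph public

-- A digraph on Fin n: D u v ≡ true means there is an arc u → v.
Digraph : ℕ → Set
Digraph n = Fin n → Fin n → Bool

IsOrientation : ∀ {n} → (Fin n → Fin n → Bool) → Digraph n → Set
IsOrientation E D =
  (∀ u v → D u v ≡ true → E u v ≡ true) ×
  (∀ u v → E u v ≡ true →
     (D u v ≡ true × D v u ≡ false) ⊎ (D u v ≡ false × D v u ≡ true))

outdeg : ∀ {n} → Digraph n → Fin n → ℕ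
outdeg {n} D v = length (filterᵇ (D v) (allFin n))

arcs : ∀ {n} → Digraph n → List (Fin n × Fin n)
arcs {n} D = filterᵇ (λ p → D (proj₁ p) (proj₂ p)) (cartesianProduct (allFin n) (allFin n))

-- all sublists (= all subsets of the arc list; arcs are distinct)
sublists : ∀ {A : Set} → List A → List (List A)
sublists []       = [] ∷ []
sublists (x ∷ xs) = map (x ∷_) (sublists xs) ++ sublists xs

eqFinᵇ : ∀ {n} → Fin n → Fin n → Bool
eqFinᵇ a b = toℕ a ≡ᵇ toℕ b

-- a spanning subdigraph given by an arc set H is Eulerian iff in-degree = out-degree everywhere
isEulerian : ∀ {n} → List (Fin n × Fin n) → Bool
isEulerian {n} H =
  and (map (λ v → length (filterᵇ (λ a → eqFinᵇ (proj₁ a) v) H)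
                  ≡ᵇ length (filterᵇ (λ a → eqFinᵇ (proj₂ a) v) H))
           (allFin n))

evenᵇ : ℕ → Bool
evenᵇ zero    = true
evenᵇ (suc m) = not (evenᵇ m)

EE : ∀ {n} → Digraph n → List (List (Fin n × Fin n))
EE D = filterᵇ (λ H → isEulerian H ∧ evenᵇ (length H)) (sublists (arcs D))

OE : ∀ {n} → Digraph n → List (List (Fin n × Fin n))
OE D = filterᵇ (λ H → isEulerian H ∧ not (evenᵇ (length H))) (sublists (arcs D))

IsAT : ∀ {n} → Digraph n → Set
IsAT D = length (EE D) ≢ length (OE D)

-- An orientation D is AT iff its signed Eulerian count, the sum over arc sets H of
-- [H Eulerian]·(-1)^|H|, is nonzero. Let D use the out-arcs of D₁ at the vertices of G₁ and
-- those of D₂ elsewhere. Since v i has out-degree i in D₂, D₂ orients the clique K transitively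
-- (v i → v j exactly when j < i), so every arc of D₂ leaving V(G₁) stays in K and points
-- downwards; such arcs lie on no Eulerian subdigraph, and the signed count of D₂ equals that of
-- its arcs with tail outside V(G₁). An arc set of D is Eulerian iff its parts inside V(G₁) and
-- outside it are, so the signed count of D is the product of the two nonzero counts.
module Submission where

open import Data.Bool using (Bool; true; false; not; T; _∧_; _∨_; if_then_else_)
open import Data.Bool.Properties using (T-∧; ∧-conicalˡ; ∧-conicalʳ; ∨-zeroʳ; ¬-not)
open import Data.Empty using (⊥; ⊥-elim)
open import Data.Fin using (Fin; toℕ; zero; suc; inject; _<_)
import Data.Fin.Induction as Fin
import Data.Fin.Properties as Fin
open import Data.Integer as ℤ using (ℤ; +_; _+_; _*_; -_; _-_) renaming (_≤_ to _≤ℤ_)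
import Data.Integer.Properties as ℤ
open import Data.Integer.Tactic.RingSolver using (solve-∀)
open import Data.List using (List; []; _∷_; [_]; _++_; map; length; filter; filterᵇ; null; allFin; cartesianProduct)
import Data.List.Properties as List
open import Data.List.Membership.Propositional using (_∈_; lose)
open import Data.List.Membership.Propositional.Properties using (∈-allFin; ∈-filter⁺; ∈-map⁻; ∈-++⁻)
open import Data.List.Relation.Binary.Permutation.Propositional using (_↭_; ↭-sym; prep)
open import Data.List.Relation.Binary.Permutation.Propositional.Properties using (shift; filter-↭; ↭-length)
open import Data.List.Relation.Binary.Subset.Propositional using (_⊆_)
open import Data.List.Relation.Unary.All as All using (All; []; _∷_)
open import Data.List.Relation.Unary.All.Properties using (all⁺; all⁻; all-filter; filter⁺)
open import Data.List.Relation.Unary.AllPairs using (_∷_)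
open import Data.List.Relation.Unary.Any using (here; there)
open import Data.List.Relation.Unary.Unique.Propositional using (Unique)
import Data.List.Relation.Unary.Unique.Propositional.Properties as Unique
open import Data.Nat as ℕ using (ℕ; _≤_; _≡ᵇ_; z≤n; s≤s)
import Data.Nat.Properties as ℕ
open import Algebra.Properties.CommutativeMonoid.Sum ℕ.+-0-commutativeMonoid
  using (sum; sum-syntax; ∑-distrib-+; sum-cong-≗; sum-replicate-zero)
open import Data.Product using (_×_; _,_; proj₁; proj₂; ∃-syntax; Σ)
open import Data.Sum using (_⊎_; inj₁; inj₂; [_,_])
open import Defs hiding (sym)
open import Function using (_∘_; id)
open import Function.Bundles using (Equivalence)
open import Function.Definitions using (Injective)
open import Induction.WellFounded using (Acc; acc)
open import Relation.Binary.Definitions using (DecidableEquality)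
open import Relation.Binary.PropositionalEquality
  using (_≡_; _≢_; refl; sym; trans; cong; cong₂; subst; subst₂; module ≡-Reasoning)
open import Relation.Nullary using (¬_; yes; no; ¬?; _×-dec_)
open import Relation.Nullary.Decidable using (T?)

true≢false : true ≢ false
true≢false ()

T⇒≡true : ∀ {b} → T b → b ≡ true
T⇒≡true {true} _ = refl

≡true⇒T : ∀ {b} → b ≡ true → T b
≡true⇒T refl = _

T-not⇒≡false : ∀ {b} → T (not b) → b ≡ false
T-not⇒≡false {false} _ = refl

T-ext : ∀ {x y} → (T x → T y) → (T y → T x) → x ≡ y
T-ext {false} {false} _ _ = refl
T-ext {false} {true}  _ g = ⊥-elim (g _)
T-ext {true}  {false} f _ = ⊥-elim (f _)
T-ext {true}  {true}  _ _ = refl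

separated : ∀ {X : Set} (f : X → Bool) {x y} → f x ≡ true → f y ≡ false → x ≢ y
separated f fx fy refl = true≢false (trans (sym fx) fy)

length-filterᵇ-map : ∀ {X Y : Set} (p : Y → Bool) (f : X → Y) xs →
  length (filterᵇ p (map f xs)) ≡ length (filterᵇ (p ∘ f) xs)
length-filterᵇ-map p f []       = refl
length-filterᵇ-map p f (x ∷ xs) with p (f x)
... | true  = cong ℕ.suc (length-filterᵇ-map p f xs)
... | false = length-filterᵇ-map p f xs

length-filterᵇ-++ : ∀ {X : Set} (p : X → Bool) xs ys →
  length (filterᵇ p (xs ++ ys)) ≡ length (filterᵇ p xs) ℕ.+ length (filterᵇ p ys)
length-filterᵇ-++ p xs ys = trans (cong length (List.filter-++ (T? ∘ p) xs ys)) (List.length-++ (filterᵇ p xs))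

length-filterᵇ-singleton : ∀ {X : Set} (p : X → Bool) x → length (filterᵇ p [ x ]) ≡ (if p x then 1 else 0)
length-filterᵇ-singleton p x with p x
... | true  = refl
... | false = refl

filterᵇ-cong : ∀ {X : Set} {p q : X → Bool} → (∀ x → p x ≡ q x) → ∀ xs → filterᵇ p xs ≡ filterᵇ q xs
filterᵇ-cong {p = p} {q} p≗q = List.filter-≐ (T? ∘ p) (T? ∘ q) (subst T (p≗q _) , subst T (sym (p≗q _)))

filterᵇ-filterᵇ-cong : ∀ {X : Set} (p : X → Bool) {q q′ : X → Bool} → (∀ x → T (p x) → q x ≡ q′ x) →
  ∀ xs → filterᵇ p (filterᵇ q xs) ≡ filterᵇ p (filterᵇ q′ xs)
filterᵇ-filterᵇ-cong p q≗q′ []       = refl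
filterᵇ-filterᵇ-cong p {q} {q′} q≗q′ (x ∷ xs) with q x in qx | q′ x in q′x
... | false | false = filterᵇ-filterᵇ-cong p q≗q′ xs
... | true  | false = trans (List.filter-reject (T? ∘ p) (λ px → true≢false (trans (sym qx) (trans (q≗q′ x px) q′x))))
                            (filterᵇ-filterᵇ-cong p q≗q′ xs)
... | false | true  = trans (filterᵇ-filterᵇ-cong p q≗q′ xs)
                            (sym (List.filter-reject (T? ∘ p) (λ px → true≢false (trans (sym q′x) (trans (sym (q≗q′ x px)) qx)))))
... | true  | true  with p x
...   | true  = cong (x ∷_) (filterᵇ-filterᵇ-cong p q≗q′ xs)
...   | false = filterᵇ-filterᵇ-cong p q≗q′ xs

Unique-⊆⇒length≤ : ∀ {X : Set} → DecidableEquality X → ∀ {xs ys : List X} →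
  Unique xs → xs ⊆ ys → length xs ≤ length ys
Unique-⊆⇒length≤ _≟_ {[]}     _                 _       = z≤n
Unique-⊆⇒length≤ _≟_ {x ∷ xs} {ys} (x∉xs ∷ uniq) x∷xs⊆ys =
  ℕ.≤-trans (s≤s (Unique-⊆⇒length≤ _≟_ uniq xs⊆ys-x))
            (List.filter-notAll (¬? ∘ (x ≟_)) ys (lose (x∷xs⊆ys (here refl)) (λ x≢x → x≢x refl)))
  where
  xs⊆ys-x : xs ⊆ filter (¬? ∘ (x ≟_)) ys
  xs⊆ys-x y∈xs = ∈-filter⁺ (¬? ∘ (x ≟_)) (x∷xs⊆ys (there y∈xs)) (All.lookup x∉xs y∈xs)

eqFinᵇ⇒≡ : ∀ {n} {x y : Fin n} → T (eqFinᵇ x y) → x ≡ y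
eqFinᵇ⇒≡ {x = x} {y} = Fin.toℕ-injective ∘ ℕ.≡ᵇ⇒≡ (toℕ x) (toℕ y)

≡⇒eqFinᵇ : ∀ {n} {x y : Fin n} → x ≡ y → T (eqFinᵇ x y)
≡⇒eqFinᵇ {x = x} {y} = ℕ.≡⇒≡ᵇ (toℕ x) (toℕ y) ∘ cong toℕ

∑-mono-≤ : ∀ {n} {f g : Fin n → ℕ} → (∀ v → f v ≤ g v) → sum f ≤ sum g
∑-mono-≤ {ℕ.zero}  f≤g = z≤n
∑-mono-≤ {ℕ.suc n} f≤g = ℕ.+-mono-≤ (f≤g zero) (∑-mono-≤ (f≤g ∘ suc))

+-≤-≡⇒≡ : ∀ {a b c d} → a ≤ b → c ≤ d → a ℕ.+ c ≡ b ℕ.+ d → a ≡ b × c ≡ d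
+-≤-≡⇒≡ {a} a≤b c≤d eq with ℕ.m≤n⇒m<n∨m≡n a≤b
... | inj₁ a<b = ⊥-elim (ℕ.<-irrefl eq (ℕ.+-mono-<-≤ a<b c≤d))
... | inj₂ refl = refl , ℕ.+-cancelˡ-≡ a _ _ eq

∑-≤-≡⇒≡ : ∀ {n} {f g : Fin n → ℕ} → (∀ v → f v ≤ g v) → sum f ≡ sum g → ∀ v → f v ≡ g v
∑-≤-≡⇒≡ {ℕ.suc n} f≤g eq zero    = proj₁ (+-≤-≡⇒≡ (f≤g zero) (∑-mono-≤ (f≤g ∘ suc)) eq)
∑-≤-≡⇒≡ {ℕ.suc n} f≤g eq (suc v) =
  ∑-≤-≡⇒≡ (f≤g ∘ suc) (proj₂ (+-≤-≡⇒≡ (f≤g zero) (∑-mono-≤ (f≤g ∘ suc)) eq)) v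

∑-eqFinᵇ : ∀ {n} (x : Fin n) → ∑[ v < n ] (if eqFinᵇ x v then 1 else 0) ≡ 1
∑-eqFinᵇ {ℕ.suc n} zero    = cong ℕ.suc (sum-replicate-zero n)
∑-eqFinᵇ {ℕ.suc n} (suc x) = ∑-eqFinᵇ x

∑-multiplicity : ∀ {n} (xs : List (Fin n)) → ∑[ v < n ] length (filterᵇ (λ y → eqFinᵇ y v) xs) ≡ length xs
∑-multiplicity {n} []  = sum-replicate-zero n
∑-multiplicity {n} (x ∷ xs) = begin
  ∑[ v < n ] length (filterᵇ (λ y → eqFinᵇ y v) ([ x ] ++ xs))
    ≡⟨ sum-cong-≗ (λ v → length-filterᵇ-++ (λ y → eqFinᵇ y v) [ x ] xs) ⟩
  ∑[ v < n ] (length (filterᵇ (λ y → eqFinᵇ y v) [ x ]) ℕ.+ length (filterᵇ (λ y → eqFinᵇ y v) xs))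
    ≡⟨ ∑-distrib-+ (λ v → length (filterᵇ (λ y → eqFinᵇ y v) [ x ])) (λ v → length (filterᵇ (λ y → eqFinᵇ y v) xs)) ⟩
  ∑[ v < n ] length (filterᵇ (λ y → eqFinᵇ y v) [ x ]) ℕ.+ ∑[ v < n ] length (filterᵇ (λ y → eqFinᵇ y v) xs)
    ≡⟨ cong₂ ℕ._+_ (trans (sum-cong-≗ (λ v → length-filterᵇ-singleton (λ y → eqFinᵇ y v) x)) (∑-eqFinᵇ x))
                   (∑-multiplicity xs) ⟩
  ℕ.suc (length xs) ∎
  where open ≡-Reasoning

-- Signed sums over sublists

indicator : Bool → ℤ
indicator true  = + 1
indicator false = + 0

module _ {X : Set} where

  sumSublists : List X → (List X → ℤ) → ℤ
  sumSublists []      F = F []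
  sumSublists (x ∷ L) F = sumSublists L (F ∘ (x ∷_)) + sumSublists L F

  length-filterᵇ-sublists : ∀ L (P : List X → Bool) →
    + length (filterᵇ P (sublists L)) ≡ sumSublists L (indicator ∘ P)
  length-filterᵇ-sublists []      P with P []
  ... | true  = refl
  ... | false = refl
  length-filterᵇ-sublists (x ∷ L) P = begin
    + length (filterᵇ P (map (x ∷_) (sublists L) ++ sublists L))
      ≡⟨ cong (+_ ∘ length) (List.filter-++ (T? ∘ P) (map (x ∷_) (sublists L)) (sublists L)) ⟩
    + length (filterᵇ P (map (x ∷_) (sublists L)) ++ filterᵇ P (sublists L))
      ≡⟨ cong +_ (List.length-++ (filterᵇ P (map (x ∷_) (sublists L)))) ⟩
    + (length (filterᵇ P (map (x ∷_) (sublists L))) ℕ.+ length (filterᵇ P (sublists L)))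
      ≡⟨ ℤ.pos-+ (length (filterᵇ P (map (x ∷_) (sublists L)))) _ ⟩
    + length (filterᵇ P (map (x ∷_) (sublists L))) + + length (filterᵇ P (sublists L))
      ≡⟨ cong₂ _+_ (trans (cong +_ (length-filterᵇ-map P (x ∷_) (sublists L)))
                          (length-filterᵇ-sublists L (P ∘ (x ∷_))))
                   (length-filterᵇ-sublists L P) ⟩
    sumSublists (x ∷ L) (indicator ∘ P) ∎
    where open ≡-Reasoning

  sumSublists-cong : ∀ L {F G : List X → ℤ} → (∀ H → F H ≡ G H) → sumSublists L F ≡ sumSublists L G
  sumSublists-cong []      F≗G = F≗G []
  sumSublists-cong (x ∷ L) F≗G = cong₂ _+_ (sumSublists-cong L (F≗G ∘ (x ∷_))) (sumSublists-cong L F≗G)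

  sumSublists-cong-All : ∀ {P : X → Set} {L} {F G : List X → ℤ} → All P L →
    (∀ H → All P H → F H ≡ G H) → sumSublists L F ≡ sumSublists L G
  sumSublists-cong-All []           F≗G = F≗G [] []
  sumSublists-cong-All (px ∷ pL) F≗G =
    cong₂ _+_ (sumSublists-cong-All pL (λ H pH → F≗G (_ ∷ H) (px ∷ pH))) (sumSublists-cong-All pL F≗G)

  sumSublists-+ : ∀ L (F G : List X → ℤ) →
    sumSublists L (λ H → F H + G H) ≡ sumSublists L F + sumSublists L G
  sumSublists-+ []      F G = refl
  sumSublists-+ (x ∷ L) F G
    rewrite sumSublists-+ L (F ∘ (x ∷_)) (G ∘ (x ∷_)) | sumSublists-+ L F G =
    interchange (sumSublists L (F ∘ (x ∷_))) (sumSublists L (G ∘ (x ∷_))) (sumSublists L F) (sumSublists L G)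
    where
    interchange : ∀ a b c d → (a + b) + (c + d) ≡ (a + c) + (b + d)
    interchange = solve-∀

  sumSublists-neg : ∀ L (F : List X → ℤ) → sumSublists L (-_ ∘ F) ≡ - sumSublists L F
  sumSublists-neg []      F = refl
  sumSublists-neg (x ∷ L) F rewrite sumSublists-neg L (F ∘ (x ∷_)) | sumSublists-neg L F =
    sym (ℤ.neg-distrib-+ (sumSublists L (F ∘ (x ∷_))) (sumSublists L F))

  sumSublists-*ʳ : ∀ L (F : List X → ℤ) c → sumSublists L (λ H → F H * c) ≡ sumSublists L F * c
  sumSublists-*ʳ []      F c = refl
  sumSublists-*ʳ (x ∷ L) F c rewrite sumSublists-*ʳ L (F ∘ (x ∷_)) c | sumSublists-*ʳ L F c =
    sym (ℤ.*-distribʳ-+ c (sumSublists L (F ∘ (x ∷_))) (sumSublists L F))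

  sumSublists-*ˡ : ∀ L c (F : List X → ℤ) → sumSublists L (λ H → c * F H) ≡ c * sumSublists L F
  sumSublists-*ˡ L c F = begin
    sumSublists L (λ H → c * F H) ≡⟨ sumSublists-cong L (λ H → ℤ.*-comm c (F H)) ⟩
    sumSublists L (λ H → F H * c) ≡⟨ sumSublists-*ʳ L F c ⟩
    sumSublists L F * c           ≡⟨ ℤ.*-comm _ c ⟩
    c * sumSublists L F           ∎
    where open ≡-Reasoning

  PermutationInvariant : (List X → ℤ) → Set
  PermutationInvariant F = ∀ {H H′} → H ↭ H′ → F H ≡ F H′

  sumSublists-partition : ∀ (p : X → Bool) L {F : List X → ℤ} → PermutationInvariant F →
    sumSublists L F ≡
    sumSublists (filterᵇ p L) (λ H₁ → sumSublists (filterᵇ (not ∘ p) L) (F ∘ (H₁ ++_)))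
  sumSublists-partition p []      F-inv = refl
  sumSublists-partition p (x ∷ L) {F} F-inv with p x
  ... | true  = cong₂ _+_ (sumSublists-partition p L (F-inv ∘ prep x)) (sumSublists-partition p L F-inv)
  ... | false = begin
    sumSublists L (F ∘ (x ∷_)) + sumSublists L F
      ≡⟨ cong₂ _+_ (sumSublists-partition p L (F-inv ∘ prep x)) (sumSublists-partition p L F-inv) ⟩
    sumSublists L₁ (λ H₁ → sumSublists L₂ (λ H₂ → F (x ∷ H₁ ++ H₂))) + sumSublists L₁ (λ H₁ → sumSublists L₂ (F ∘ (H₁ ++_)))
      ≡⟨ sym (sumSublists-+ L₁ _ _) ⟩
    sumSublists L₁ (λ H₁ → sumSublists L₂ (λ H₂ → F (x ∷ H₁ ++ H₂)) + sumSublists L₂ (F ∘ (H₁ ++_)))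
      ≡⟨ sumSublists-cong L₁ (λ H₁ → cong (_+ _) (sumSublists-cong L₂ (λ H₂ → F-inv (↭-sym (shift x H₁ H₂))))) ⟩
    sumSublists L₁ (λ H₁ → sumSublists L₂ (λ H₂ → F (H₁ ++ x ∷ H₂)) + sumSublists L₂ (F ∘ (H₁ ++_))) ∎
    where
    open ≡-Reasoning
    L₁ = filterᵇ p L
    L₂ = filterᵇ (not ∘ p) L

  sumSublists-factorise : ∀ {P Q : X → Set} {L₁ L₂} {F f g : List X → ℤ} → All P L₁ → All Q L₂ →
    (∀ H₁ H₂ → All P H₁ → All Q H₂ → F (H₁ ++ H₂) ≡ f H₁ * g H₂) →
    sumSublists L₁ (λ H₁ → sumSublists L₂ (F ∘ (H₁ ++_))) ≡ sumSublists L₁ f * sumSublists L₂ g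
  sumSublists-factorise {L₁ = L₁} {L₂} {F} {f} {g} PL₁ QL₂ F≡f*g = begin
    sumSublists L₁ (λ H₁ → sumSublists L₂ (F ∘ (H₁ ++_)))
      ≡⟨ sumSublists-cong-All PL₁ (λ H₁ PH₁ → sumSublists-cong-All QL₂ (λ H₂ → F≡f*g H₁ H₂ PH₁)) ⟩
    sumSublists L₁ (λ H₁ → sumSublists L₂ (λ H₂ → f H₁ * g H₂))
      ≡⟨ sumSublists-cong L₁ (λ H₁ → sumSublists-*ˡ L₂ (f H₁) g) ⟩
    sumSublists L₁ (λ H₁ → f H₁ * sumSublists L₂ g)
      ≡⟨ sumSublists-*ʳ L₁ f (sumSublists L₂ g) ⟩
    sumSublists L₁ f * sumSublists L₂ g ∎
    where open ≡-Reasoning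

  sumSublists-partition-factorise : ∀ (p : X → Bool) L {P Q : X → Set} {F f g : List X → ℤ} →
    PermutationInvariant F → All P (filterᵇ p L) → All Q (filterᵇ (not ∘ p) L) →
    (∀ H₁ H₂ → All P H₁ → All Q H₂ → F (H₁ ++ H₂) ≡ f H₁ * g H₂) →
    sumSublists L F ≡ sumSublists (filterᵇ p L) f * sumSublists (filterᵇ (not ∘ p) L) g
  sumSublists-partition-factorise p L {F = F} F-inv PL₁ QL₂ F≡f*g =
    trans (sumSublists-partition p L {F} F-inv) (sumSublists-factorise {F = F} PL₁ QL₂ F≡f*g)

  sumSublists-null : ∀ L → sumSublists L (indicator ∘ null) ≡ + 1
  sumSublists-null []      = refl
  sumSublists-null (x ∷ L) = begin
    sumSublists L (λ _ → + 0) + sumSublists L (indicator ∘ null)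
      ≡⟨ cong₂ _+_ (sumSublists-*ˡ L (+ 0) (λ _ → + 0)) (sumSublists-null L) ⟩
    + 1 ∎
    where open ≡-Reasoning

Arc : ℕ → Set
Arc n = Fin n × Fin n

module _ {n : ℕ} where

  endCount : (Arc n → Fin n) → List (Arc n) → Fin n → ℕ
  endCount end H v = length (filterᵇ (λ a → eqFinᵇ (end a) v) H)

  Balanced : List (Arc n) → Set
  Balanced H = ∀ v → endCount proj₁ H v ≡ endCount proj₂ H v

  isEulerian⇒Balanced : ∀ H → T (isEulerian H) → Balanced H
  isEulerian⇒Balanced H eul v = ℕ.≡ᵇ⇒≡ (endCount proj₁ H v) (endCount proj₂ H v)
    (All.lookup (all⁺ (λ v → endCount proj₁ H v ≡ᵇ endCount proj₂ H v) (allFin n) eul) (∈-allFin v))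

  Balanced⇒isEulerian : ∀ H → Balanced H → T (isEulerian H)
  Balanced⇒isEulerian H bal =
    all⁻ (λ v → endCount proj₁ H v ≡ᵇ endCount proj₂ H v) {allFin n} (All.tabulate (λ {v} _ → ℕ.≡⇒≡ᵇ _ _ (bal v)))

  endCount-++ : ∀ end H₁ H₂ v → endCount end (H₁ ++ H₂) v ≡ endCount end H₁ v ℕ.+ endCount end H₂ v
  endCount-++ end H₁ H₂ v = length-filterᵇ-++ (λ a → eqFinᵇ (end a) v) H₁ H₂

  endCount-↭ : ∀ end {H H′} → H ↭ H′ → ∀ v → endCount end H v ≡ endCount end H′ v
  endCount-↭ end H↭H′ v = ↭-length (filter-↭ (T? ∘ λ a → eqFinᵇ (end a) v) H↭H′)

  isEulerian-↭ : ∀ {H H′} → H ↭ H′ → isEulerian H ≡ isEulerian H′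
  isEulerian-↭ {H} {H′} H↭H′ = T-ext
    (λ eul → Balanced⇒isEulerian H′ λ v →
       trans (sym (endCount-↭ proj₁ H↭H′ v)) (trans (isEulerian⇒Balanced H eul v) (endCount-↭ proj₂ H↭H′ v)))
    (λ eul → Balanced⇒isEulerian H λ v →
       trans (endCount-↭ proj₁ H↭H′ v) (trans (isEulerian⇒Balanced H′ eul v) (sym (endCount-↭ proj₂ H↭H′ v))))

  ∑-endCount : ∀ end H → ∑[ v < n ] endCount end H v ≡ length H
  ∑-endCount end H = begin
    ∑[ v < n ] endCount end H v
      ≡⟨ sum-cong-≗ (λ v → sym (length-filterᵇ-map (λ y → eqFinᵇ y v) end H)) ⟩
    ∑[ v < n ] length (filterᵇ (λ y → eqFinᵇ y v) (map end H))
      ≡⟨ ∑-multiplicity (map end H) ⟩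
    length (map end H)
      ≡⟨ List.length-map end H ⟩
    length H ∎
    where open ≡-Reasoning

  -- Both totals equal the length of H.
  tails≤heads⇒Balanced : ∀ {H} → (∀ v → endCount proj₁ H v ≤ endCount proj₂ H v) → Balanced H
  tails≤heads⇒Balanced {H} t≤h = ∑-≤-≡⇒≡ t≤h (trans (∑-endCount proj₁ H) (sym (∑-endCount proj₂ H)))

  endCount-none : ∀ end {H} v → All (λ a → end a ≢ v) H → endCount end H v ≡ 0
  endCount-none end v ≢v = cong length (List.filter-none (T? ∘ λ a → eqFinᵇ (end a) v) (All.map (_∘ eqFinᵇ⇒≡) ≢v))

  endCount-zero : ∀ end {H a} v → endCount end H v ≡ 0 → a ∈ H → end a ≢ v
  endCount-zero end v count≡0 a∈H end≡v =
    ℕ.<-irrefl (sym count≡0) (List.filter-some (T? ∘ λ a → eqFinᵇ (end a) v) (lose a∈H (≡⇒eqFinᵇ end≡v)))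

  -- H₂ has no tail in A, and H₁ touches no vertex outside A; so H₂ has at most as many tails as
  -- heads everywhere, hence is balanced.
  module _ (A : Fin n → Bool) {H₁ H₂ : List (Arc n)}
    (H₁⊆A : All (λ a → A (proj₁ a) ≡ true × A (proj₂ a) ≡ true) H₁)
    (tails₂∉A : All (λ a → A (proj₁ a) ≡ false) H₂) where

    Balanced-++⁻ : Balanced (H₁ ++ H₂) → Balanced H₁ × Balanced H₂
    Balanced-++⁻ bal = bal₁ , bal₂
      where
      open ≡-Reasoning
      tails₂≤heads₂ : ∀ v → endCount proj₁ H₂ v ≤ endCount proj₂ H₂ v
      tails₂≤heads₂ v with A v in Av
      ... | true  = ℕ.≤-trans (ℕ.≤-reflexive (endCount-none proj₁ v
                      (All.map (λ Aa e → separated A Av Aa (sym e)) tails₂∉A))) z≤n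
      ... | false = ℕ.≤-reflexive (begin
        endCount proj₁ H₂ v                         ≡⟨ cong (ℕ._+ _) (sym (endCount-none proj₁ v (All.map (λ Aa → separated A (proj₁ Aa) Av) H₁⊆A))) ⟩
        endCount proj₁ H₁ v ℕ.+ endCount proj₁ H₂ v ≡⟨ sym (endCount-++ proj₁ H₁ H₂ v) ⟩
        endCount proj₁ (H₁ ++ H₂) v                 ≡⟨ bal v ⟩
        endCount proj₂ (H₁ ++ H₂) v                 ≡⟨ endCount-++ proj₂ H₁ H₂ v ⟩
        endCount proj₂ H₁ v ℕ.+ endCount proj₂ H₂ v ≡⟨ cong (ℕ._+ _) (endCount-none proj₂ v (All.map (λ Aa → separated A (proj₂ Aa) Av) H₁⊆A)) ⟩
        endCount proj₂ H₂ v                         ∎)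
      bal₂ : Balanced H₂
      bal₂ = tails≤heads⇒Balanced {H₂} tails₂≤heads₂
      bal₁ : Balanced H₁
      bal₁ v = ℕ.+-cancelʳ-≡ (endCount proj₁ H₂ v) _ _ (begin
        endCount proj₁ H₁ v ℕ.+ endCount proj₁ H₂ v ≡⟨ sym (endCount-++ proj₁ H₁ H₂ v) ⟩
        endCount proj₁ (H₁ ++ H₂) v                 ≡⟨ bal v ⟩
        endCount proj₂ (H₁ ++ H₂) v                 ≡⟨ endCount-++ proj₂ H₁ H₂ v ⟩
        endCount proj₂ H₁ v ℕ.+ endCount proj₂ H₂ v ≡⟨ cong (endCount proj₂ H₁ v ℕ.+_) (sym (bal₂ v)) ⟩
        endCount proj₂ H₁ v ℕ.+ endCount proj₁ H₂ v ∎)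

    isEulerian-++ : isEulerian (H₁ ++ H₂) ≡ isEulerian H₁ ∧ isEulerian H₂
    isEulerian-++ = T-ext
      (λ eul → let bal₁ , bal₂ = Balanced-++⁻ (isEulerian⇒Balanced (H₁ ++ H₂) eul) in
               Equivalence.from T-∧ (Balanced⇒isEulerian H₁ bal₁ , Balanced⇒isEulerian H₂ bal₂))
      (λ eul → let eul₁ , eul₂ = Equivalence.to (T-∧ {isEulerian H₁}) eul in
               Balanced⇒isEulerian (H₁ ++ H₂) λ v → begin
        endCount proj₁ (H₁ ++ H₂) v                 ≡⟨ endCount-++ proj₁ H₁ H₂ v ⟩
        endCount proj₁ H₁ v ℕ.+ endCount proj₁ H₂ v ≡⟨ cong₂ ℕ._+_ (isEulerian⇒Balanced H₁ eul₁ v) (isEulerian⇒Balanced H₂ eul₂ v) ⟩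
        endCount proj₂ H₁ v ℕ.+ endCount proj₂ H₂ v ≡⟨ sym (endCount-++ proj₂ H₁ H₂ v) ⟩
        endCount proj₂ (H₁ ++ H₂) v                 ∎)
      where open ≡-Reasoning

-- Signed Eulerian counts

sign : ℕ → ℤ
sign ℕ.zero    = + 1
sign (ℕ.suc m) = - sign m

sign-+ : ∀ m k → sign (m ℕ.+ k) ≡ sign m * sign k
sign-+ ℕ.zero    k = sym (ℤ.*-identityˡ (sign k))
sign-+ (ℕ.suc m) k = trans (cong -_ (sign-+ m k)) (ℤ.neg-distribˡ-* (sign m) (sign k))

indicator-evenᵇ : ∀ m → indicator (evenᵇ m) - indicator (not (evenᵇ m)) ≡ sign m
indicator-evenᵇ ℕ.zero    = refl
indicator-evenᵇ (ℕ.suc m) = trans (swap (evenᵇ m)) (cong -_ (indicator-evenᵇ m))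
  where
  swap : ∀ b → indicator (not b) - indicator (not (not b)) ≡ - (indicator b - indicator (not b))
  swap true  = refl
  swap false = refl

eulerWeight : ∀ {n} → List (Arc n) → ℤ
eulerWeight H = if isEulerian H then sign (length H) else + 0

eulerWeight-↭ : ∀ {n} → PermutationInvariant (eulerWeight {n})
eulerWeight-↭ H↭H′ rewrite isEulerian-↭ H↭H′ | ↭-length H↭H′ = refl

eulerWeight-++ : ∀ {n} (H₁ H₂ : List (Arc n)) → isEulerian (H₁ ++ H₂) ≡ isEulerian H₁ ∧ isEulerian H₂ →
  eulerWeight (H₁ ++ H₂) ≡ eulerWeight H₁ * eulerWeight H₂
eulerWeight-++ H₁ H₂ eul rewrite eul | List.length-++ H₁ {H₂} | sign-+ (length H₁) (length H₂)
  with isEulerian H₁ | isEulerian H₂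
... | true  | true  = refl
... | true  | false = sym (ℤ.*-zeroʳ (sign (length H₁)))
... | false | _     = refl

signedEulerianCount : ∀ {n} → Digraph n → ℤ
signedEulerianCount D = sumSublists (arcs D) eulerWeight

signedEulerianCount-≡ : ∀ {n} (D : Digraph n) → + length (EE D) - + length (OE D) ≡ signedEulerianCount D
signedEulerianCount-≡ D = begin
  + length (EE D) - + length (OE D)
    ≡⟨ cong₂ _-_ (length-filterᵇ-sublists (arcs D) _) (length-filterᵇ-sublists (arcs D) _) ⟩
  sumSublists (arcs D) even + - sumSublists (arcs D) odd
    ≡⟨ cong (λ z → sumSublists (arcs D) even + z) (sym (sumSublists-neg (arcs D) odd)) ⟩
  sumSublists (arcs D) even + sumSublists (arcs D) (-_ ∘ odd)
    ≡⟨ sym (sumSublists-+ (arcs D) even (-_ ∘ odd)) ⟩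
  sumSublists (arcs D) (λ H → even H - odd H)
    ≡⟨ sumSublists-cong (arcs D) weight ⟩
  signedEulerianCount D ∎
  where
  open ≡-Reasoning
  even odd : List (Arc _) → ℤ
  even H = indicator (isEulerian H ∧ evenᵇ (length H))
  odd  H = indicator (isEulerian H ∧ not (evenᵇ (length H)))
  weight : ∀ H → even H - odd H ≡ eulerWeight H
  weight H with isEulerian H
  ... | true  = indicator-evenᵇ (length H)
  ... | false = refl

IsAT⇒signedEulerianCount≢0 : ∀ {n} (D : Digraph n) → IsAT D → signedEulerianCount D ≢ + 0
IsAT⇒signedEulerianCount≢0 D at ≡0 =
  at (ℤ.+-injective (ℤ.i-j≡0⇒i≡j _ _ (trans (signedEulerianCount-≡ D) ≡0)))

signedEulerianCount≢0⇒IsAT : ∀ {n} (D : Digraph n) → signedEulerianCount D ≢ + 0 → IsAT D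
signedEulerianCount≢0⇒IsAT D ≢0 EE≡OE =
  ≢0 (trans (sym (signedEulerianCount-≡ D)) (trans (cong (λ m → + m - + length (OE D)) EE≡OE) (ℤ.+-inverseʳ (+ length (OE D)))))

-- Transitively oriented cliques

outdeg-lowerBound : ∀ {n k} {D : Digraph n} (v : Fin k → Fin n) → Injective _≡_ _≡_ v → ∀ i {y} → (∀ j → j < i → D (v i) (v j) ≡ true) → D (v i) y ≡ true →
  (∀ j → j < i → v j ≢ y) → toℕ i ℕ.< outdeg D (v i)
outdeg-lowerBound {n} {k} {D} v v-injective i {y} arcs-down Dvi-y y-new =
  subst (ℕ._≤ outdeg D (v i))
    (cong ℕ.suc (trans (List.length-map (v ∘ lower) (allFin (toℕ i))) (List.length-tabulate id)))
    (Unique-⊆⇒length≤ Fin._≟_ witnesses-unique witnesses⊆outNeighbours)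
  where
  lower : Fin (toℕ i) → Fin k
  lower = inject

  lower<i : ∀ t → lower t < i
  lower<i t = subst (ℕ._< toℕ i) (sym (Fin.toℕ-inject t)) (Fin.toℕ<n t)

  lower-injective : Injective _≡_ _≡_ lower
  lower-injective {s} {t} e =
    Fin.toℕ-injective (trans (sym (Fin.toℕ-inject s)) (trans (cong toℕ e) (Fin.toℕ-inject t)))

  witnesses : List (Fin n)
  witnesses = y ∷ map (v ∘ lower) (allFin (toℕ i))

  witnesses-unique : Unique witnesses
  witnesses-unique =
    All.tabulate (λ y′∈ y≡y′ → let t , _ , y′≡ = ∈-map⁻ (v ∘ lower) y′∈ in
                               y-new (lower t) (lower<i t) (sym (trans y≡y′ y′≡)))
    ∷ Unique.map⁺ (lower-injective ∘ v-injective) (Unique.allFin⁺ (toℕ i))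

  witnesses⊆outNeighbours : witnesses ⊆ filterᵇ (D (v i)) (allFin n)
  witnesses⊆outNeighbours (here refl) = ∈-filter⁺ (T? ∘ D (v i)) (∈-allFin y) (≡true⇒T Dvi-y)
  witnesses⊆outNeighbours (there y′∈) with ∈-map⁻ (v ∘ lower) y′∈
  ... | t , _ , refl = ∈-filter⁺ (T? ∘ D (v i)) (∈-allFin _) (≡true⇒T (arcs-down (lower t) (lower<i t)))

-- With out-degree i at v i, the orientation of the clique is forced to be transitive:
-- v i → v j for every j < i, and these are all the out-neighbours of v i.
module _ {n k : ℕ} {E : Fin n → Fin n → Bool} {D : Digraph n} (D-orients-E : IsOrientation E D)
  (v : Fin k → Fin n) (v-injective : Injective _≡_ _≡_ v)
  (v-clique : ∀ i j → i ≢ j → E (v i) (v j) ≡ true)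
  (outdeg-v : ∀ i → outdeg D (v i) ≡ toℕ i) where

  outNeighbour-below : ∀ i {y} → D (v i) y ≡ true → ∃[ j ] j < i × v j ≡ y
  outNeighbour-below i = go i (Fin.<-wellFounded i)
    where
    go : ∀ i → Acc _<_ i → ∀ {y} → D (v i) y ≡ true → ∃[ j ] j < i × v j ≡ y
    go i (acc below) {y} Dvi-y with Fin.any? (λ j → (j Fin.<? i) ×-dec (v j Fin.≟ y))
    ... | yes found = found
    ... | no  none  = ⊥-elim (ℕ.<-irrefl (sym (outdeg-v i))
                        (outdeg-lowerBound {D = D} v v-injective i arc-down Dvi-y (λ j j<i vj≡y → none (j , j<i , vj≡y))))
      where
      arc-down : ∀ j → j < i → D (v i) (v j) ≡ true
      arc-down j j<i with proj₂ D-orients-E (v i) (v j) (v-clique i j (λ i≡j → Fin.<-irrefl (sym i≡j) j<i))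
      ... | inj₁ (Dij , _) = Dij
      ... | inj₂ (_ , Dji) with go j (below j<i) Dji
      ...   | j′ , j′<j , vj′≡vi with v-injective vj′≡vi
      ...     | refl = ⊥-elim (Fin.<-asym j<i j′<j)

-- An arc leaving v i enters some v j with j < i; by induction no arc leaves v j, hence
-- (by balance) none enters it, a contradiction.
module _ {n k : ℕ} (v : Fin k → Fin n) {H : List (Arc n)} (bal : Balanced H)
  (descends : ∀ {a} i → a ∈ H → proj₁ a ≡ v i → ∃[ j ] j < i × proj₂ a ≡ v j) where

  descending-Balanced⇒no-tail-in-v : ∀ i → endCount proj₁ H (v i) ≡ 0
  descending-Balanced⇒no-tail-in-v i = go i (Fin.<-wellFounded i)
    where
    go : ∀ i → Acc _<_ i → endCount proj₁ H (v i) ≡ 0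
    go i (acc below) = endCount-none proj₁ (v i) (All.tabulate λ a∈H tail≡vi →
      let j , j<i , head≡vj = descends i a∈H tail≡vi
      in endCount-zero proj₂ (v j) (trans (sym (bal (v j))) (go j (below j<i))) a∈H head≡vj)

-- Gluing D₁ and D₂

module Gluing {n k : ℕ} (G₁ G₂ G : SimpleGraph n) (A B : Fin n → Bool)
  (v : Fin k → Fin n) (v-injective : Injective _≡_ _≡_ v)
  (G₁⊆A : ∀ x y → adj G₁ x y ≡ true → A x ≡ true × A y ≡ true)
  (G₂⊆B : ∀ x y → adj G₂ x y ≡ true → B x ≡ true × B y ≡ true)
  (A∩B⊆K : ∀ x → A x ∧ B x ≡ true → ∃[ i ] v i ≡ x)
  (K⊆A∩B : ∀ i → A (v i) ∧ B (v i) ≡ true)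
  (K-clique₁ : ∀ i j → i ≢ j → adj G₁ (v i) (v j) ≡ true)
  (K-clique₂ : ∀ i j → i ≢ j → adj G₂ (v i) (v j) ≡ true)
  (G⊆G₁∪G₂ : ∀ x y → adj G x y ≡ true → adj G₁ x y ∨ adj G₂ x y ≡ true)
  (G₁∪G₂⊆G : ∀ x y → adj G₁ x y ∨ adj G₂ x y ≡ true →
     ¬ ((∃[ i ] v i ≡ x) × (∃[ j ] v j ≡ y)) → adj G x y ≡ true)
  (D₁ : Digraph n) (D₁-orients : IsOrientation (λ x y → adj G₁ x y ∧ adj G x y) D₁)
  (D₂ : Digraph n) (D₂-orients : IsOrientation (adj G₂) D₂)
  (outdeg-v : ∀ i → outdeg D₂ (v i) ≡ toℕ i) where

  D : Digraph n
  D x y = if A x then D₁ x y else D₂ x y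

  D-on-A : ∀ {x} y → A x ≡ true → D x y ≡ D₁ x y
  D-on-A {x} y Ax = cong (λ b → if b then D₁ x y else D₂ x y) Ax

  D-off-A : ∀ {x} y → A x ≡ false → D x y ≡ D₂ x y
  D-off-A {x} y Ax = cong (λ b → if b then D₁ x y else D₂ x y) Ax

  v∈A : ∀ i → A (v i) ≡ true
  v∈A i = ∧-conicalˡ _ _ (K⊆A∩B i)

  D₁⊆A : ∀ x y → D₁ x y ≡ true → A x ≡ true × A y ≡ true
  D₁⊆A x y D₁xy = G₁⊆A x y (∧-conicalˡ _ _ (proj₁ D₁-orients x y D₁xy))

  D₂-arc-from-A : ∀ {x y} → A x ≡ true → D₂ x y ≡ true → ∃[ i ] v i ≡ x × ∃[ j ] j < i × v j ≡ y
  D₂-arc-from-A {x} {y} Ax D₂xy with A∩B⊆K x (cong₂ _∧_ Ax (proj₁ (G₂⊆B x y (proj₁ D₂-orients x y D₂xy))))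
  ... | i , refl = i , refl , outNeighbour-below D₂-orients v v-injective K-clique₂ outdeg-v i D₂xy

  D₂-arc-from-A-in-G₁ : ∀ {x y} → A x ≡ true → D₂ x y ≡ true → adj G₁ x y ≡ true
  D₂-arc-from-A-in-G₁ Ax D₂xy with D₂-arc-from-A Ax D₂xy
  ... | i , refl , j , j<i , refl = K-clique₁ i j (λ i≡j → Fin.<-irrefl (sym i≡j) j<i)

  tailInA : Arc n → Bool
  tailInA a = A (proj₁ a)

  arcsOffA₂ : List (Arc n)
  arcsOffA₂ = filterᵇ (not ∘ tailInA) (arcs D₂)

  tailsOffA : ∀ {d : Digraph n} → All (λ a → A (proj₁ a) ≡ false) (filterᵇ (not ∘ tailInA) (arcs d))
  tailsOffA {d} = All.map T-not⇒≡false (all-filter (T? ∘ not ∘ tailInA) (arcs d))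

  -- Arcs of D₂ leaving A run downwards inside K, so no balanced arc set contains one.
  no-Eulerian-through-A : ∀ a H₁ H₂ →
    All (λ a → A (proj₁ a) ≡ true × D₂ (proj₁ a) (proj₂ a) ≡ true) (a ∷ H₁) →
    All (λ a → A (proj₁ a) ≡ false) H₂ → isEulerian (a ∷ H₁ ++ H₂) ≡ false
  no-Eulerian-through-A a H₁ H₂ H₁-from-A H₂-off-A =
    ¬-not (λ eul → contradiction (≡true⇒T eul))
    where
    H = a ∷ H₁ ++ H₂
    descends : ∀ {b} i → b ∈ H → proj₁ b ≡ v i → ∃[ j ] j < i × proj₂ b ≡ v j
    descends {b} i b∈H tail≡vi with ∈-++⁻ (a ∷ H₁) b∈H
    ... | inj₂ b∈H₂ = ⊥-elim (separated A (v∈A i) (All.lookup H₂-off-A b∈H₂) (sym tail≡vi))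
    ... | inj₁ b∈H₁ with All.lookup H₁-from-A b∈H₁
    ...   | Ab , D₂b with D₂-arc-from-A Ab D₂b
    ...     | i′ , vi′≡tail , j , j<i′ , vj≡head with v-injective (trans vi′≡tail tail≡vi)
    ...       | refl = j , j<i′ , sym vj≡head
    contradiction : T (isEulerian H) → ⊥
    contradiction eul with All.lookup H₁-from-A (here refl)
    ... | Aa , D₂a with D₂-arc-from-A Aa D₂a
    ...   | i , vi≡tail , _ =
      endCount-zero proj₁ (v i) (descending-Balanced⇒no-tail-in-v v (isEulerian⇒Balanced H eul) descends i)
        (here refl) (sym vi≡tail)

  arcsOnA-D : filterᵇ tailInA (arcs D) ≡ arcs D₁
  arcsOnA-D = trans (filterᵇ-filterᵇ-cong tailInA (λ a Aa → D-on-A (proj₂ a) (T⇒≡true Aa)) pairs)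
                    (List.filter-all (T? ∘ tailInA) (All.map (≡true⇒T ∘ proj₁ ∘ D₁⊆A _ _ ∘ T⇒≡true) (all-filter _ pairs)))
    where pairs = cartesianProduct (allFin n) (allFin n)

  arcsOffA-D : filterᵇ (not ∘ tailInA) (arcs D) ≡ arcsOffA₂
  arcsOffA-D = filterᵇ-filterᵇ-cong (not ∘ tailInA) (λ a ¬Aa → D-off-A (proj₂ a) (T-not⇒≡false ¬Aa))
                 (cartesianProduct (allFin n) (allFin n))

  signedEulerianCount-D₂ : signedEulerianCount D₂ ≡ sumSublists arcsOffA₂ eulerWeight
  signedEulerianCount-D₂ = begin
    sumSublists (arcs D₂) eulerWeight
      ≡⟨ sumSublists-partition-factorise tailInA (arcs D₂) eulerWeight-↭ arcsFromA tailsOffA factor ⟩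
    sumSublists (filterᵇ tailInA (arcs D₂)) (indicator ∘ null) * sumSublists arcsOffA₂ eulerWeight
      ≡⟨ cong (_* sumSublists arcsOffA₂ eulerWeight) (sumSublists-null (filterᵇ tailInA (arcs D₂))) ⟩
    + 1 * sumSublists arcsOffA₂ eulerWeight
      ≡⟨ ℤ.*-identityˡ _ ⟩
    sumSublists arcsOffA₂ eulerWeight ∎
    where
    open ≡-Reasoning
    arcsFromA : All (λ a → A (proj₁ a) ≡ true × D₂ (proj₁ a) (proj₂ a) ≡ true) (filterᵇ tailInA (arcs D₂))
    arcsFromA = All.map (λ (Aa , D₂a) → T⇒≡true Aa , T⇒≡true D₂a)
      (All.zip (all-filter (T? ∘ tailInA) (arcs D₂) , filter⁺ (T? ∘ tailInA) (all-filter _ (cartesianProduct (allFin n) (allFin n)))))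
    factor : ∀ H₁ H₂ → All (λ a → A (proj₁ a) ≡ true × D₂ (proj₁ a) (proj₂ a) ≡ true) H₁ →
      All (λ a → A (proj₁ a) ≡ false) H₂ → eulerWeight (H₁ ++ H₂) ≡ indicator (null H₁) * eulerWeight H₂
    factor []       H₂ _     _     = sym (ℤ.*-identityˡ (eulerWeight H₂))
    factor (a ∷ H₁) H₂ H₁-from-A H₂-off-A =
      cong (λ b → if b then sign (length (a ∷ H₁ ++ H₂)) else + 0) (no-Eulerian-through-A a H₁ H₂ H₁-from-A H₂-off-A)

  signedEulerianCount-D : signedEulerianCount D ≡ signedEulerianCount D₁ * sumSublists arcsOffA₂ eulerWeight
  signedEulerianCount-D = begin
    sumSublists (arcs D) eulerWeight
      ≡⟨ sumSublists-partition-factorise tailInA (arcs D) eulerWeight-↭ arcsInsideA tailsOffA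
           (λ H₁ H₂ H₁⊆A H₂-off-A → eulerWeight-++ H₁ H₂ (isEulerian-++ A H₁⊆A H₂-off-A)) ⟩
    sumSublists (filterᵇ tailInA (arcs D)) eulerWeight * sumSublists (filterᵇ (not ∘ tailInA) (arcs D)) eulerWeight
      ≡⟨ cong₂ (λ L₁ L₂ → sumSublists L₁ eulerWeight * sumSublists L₂ eulerWeight) arcsOnA-D arcsOffA-D ⟩
    signedEulerianCount D₁ * sumSublists arcsOffA₂ eulerWeight ∎
    where
    open ≡-Reasoning
    arcsInsideA : All (λ a → A (proj₁ a) ≡ true × A (proj₂ a) ≡ true) (filterᵇ tailInA (arcs D))
    arcsInsideA = subst (All _) (sym arcsOnA-D)
      (All.map (D₁⊆A _ _ ∘ T⇒≡true) (all-filter _ (cartesianProduct (allFin n) (allFin n))))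

  D-off-G₁ : ∀ {x y} → adj G₁ x y ≡ false → D x y ≡ D₂ x y
  D-off-G₁ {x} {y} ¬G₁xy with A x in Ax
  ... | false = refl
  ... | true  = trans
    (¬-not (λ D₁xy → true≢false (trans (sym (∧-conicalˡ _ _ (proj₁ D₁-orients x y D₁xy))) ¬G₁xy)))
    (sym (¬-not (λ D₂xy → true≢false (trans (sym (D₂-arc-from-A-in-G₁ Ax D₂xy)) ¬G₁xy))))

  OneWay : Bool → Bool → Set
  OneWay d d′ = (d ≡ true × d′ ≡ false) ⊎ (d ≡ false × d′ ≡ true)

  D-orients-G : IsOrientation (adj G) D
  D-orients-G = arc⇒edge , edge⇒oneWay
    where
    arc⇒edge : ∀ x y → D x y ≡ true → adj G x y ≡ true
    arc⇒edge x y Dxy with A x in Ax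
    ... | true  = ∧-conicalʳ _ _ (proj₁ D₁-orients x y Dxy)
    ... | false = G₁∪G₂⊆G x y (trans (cong (adj G₁ x y ∨_) (proj₁ D₂-orients x y Dxy))
                                     (∨-zeroʳ (adj G₁ x y)))
                    (λ ((i , vi≡x) , _) → separated A (v∈A i) Ax vi≡x)
    edge⇒oneWay : ∀ x y → adj G x y ≡ true → OneWay (D x y) (D y x)
    edge⇒oneWay x y Gxy with adj G₁ x y in G₁xy
    ... | true  = subst₂ OneWay (sym (D-on-A y (proj₁ (G₁⊆A x y G₁xy)))) (sym (D-on-A x (proj₂ (G₁⊆A x y G₁xy))))
                    (proj₂ D₁-orients x y (cong₂ _∧_ G₁xy Gxy))
    ... | false = subst₂ OneWay (sym (D-off-G₁ G₁xy)) (sym (D-off-G₁ (trans (SimpleGraph.sym G₁ y x) G₁xy)))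
                    (proj₂ D₂-orients x y (subst (λ b → b ∨ adj G₂ x y ≡ true) G₁xy (G⊆G₁∪G₂ x y Gxy)))

  outdeg-D-on-A : ∀ {x} → A x ≡ true → outdeg D x ≡ outdeg D₁ x
  outdeg-D-on-A Ax = cong length (filterᵇ-cong (λ y → D-on-A y Ax) (allFin n))

lemma2p3 : ∀ {n k : ℕ} → 1 ≤ k →
    (G₁ G₂ G : SimpleGraph n) →
    (A B : Fin n → Bool) →
    (v : Fin k → Fin n) → Injective _≡_ _≡_ v →
    (∀ x y → adj G₁ x y ≡ true → A x ≡ true × A y ≡ true) →
    (∀ x y → adj G₂ x y ≡ true → B x ≡ true × B y ≡ true) →
    (∀ x → A x ∨ B x ≡ true) →
    (∀ x → A x ∧ B x ≡ true → ∃[ i ] v i ≡ x) →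
    (∀ i → A (v i) ∧ B (v i) ≡ true) →
    (∀ i j → i ≢ j → adj G₁ (v i) (v j) ≡ true) →
    (∀ i j → i ≢ j → adj G₂ (v i) (v j) ≡ true) →
    (∀ x y → adj G x y ≡ true → adj G₁ x y ∨ adj G₂ x y ≡ true) →
    (∀ x y → adj G₁ x y ∨ adj G₂ x y ≡ true →
       ¬ ((∃[ i ] v i ≡ x) × (∃[ j ] v j ≡ y)) → adj G x y ≡ true) →
    (ℓ : ℤ) →
    (D₁ : Digraph n) →
    IsOrientation (λ x y → adj G₁ x y ∧ adj G x y) D₁ → IsAT D₁ →
    (∀ x → A x ≡ true → + outdeg D₁ x ≤ℤ ℓ) →
    (D₂ : Digraph n) →
    IsOrientation (adj G₂) D₂ → IsAT D₂ →
    (∀ x → B x ≡ true → + outdeg D₂ x ≤ℤ ℓ) →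
    (∀ i → outdeg D₂ (v i) ≡ toℕ i) →
    Σ (Digraph n) λ D →
      IsOrientation (adj G) D × IsAT D ×
      (∀ x → + outdeg D x ≤ℤ ℓ) ×
      (∀ x → A x ≡ true → outdeg D x ≡ outdeg D₁ x)
lemma2p3 _ G₁ G₂ G A B v v-injective G₁⊆A G₂⊆B A∪B A∩B⊆K K⊆A∩B K-clique₁ K-clique₂ G⊆G₁∪G₂ G₁∪G₂⊆G
         ℓ D₁ D₁-orients D₁-AT D₁-bounded D₂ D₂-orients D₂-AT D₂-bounded outdeg-v =
  D , D-orients-G , D-AT , D-bounded , λ x → outdeg-D-on-A
  where
  open Gluing G₁ G₂ G A B v v-injective G₁⊆A G₂⊆B A∩B⊆K K⊆A∩B K-clique₁ K-clique₂ G⊆G₁∪G₂ G₁∪G₂⊆G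
              D₁ D₁-orients D₂ D₂-orients outdeg-v
  D-AT : IsAT D
  D-AT = signedEulerianCount≢0⇒IsAT D λ σ≡0 →
    [_,_] (IsAT⇒signedEulerianCount≢0 D₁ D₁-AT)
          (IsAT⇒signedEulerianCount≢0 D₂ D₂-AT ∘ trans signedEulerianCount-D₂)
          (ℤ.i*j≡0⇒i≡0∨j≡0 (signedEulerianCount D₁) (trans (sym signedEulerianCount-D) σ≡0))
  D-bounded : ∀ x → + outdeg D x ≤ℤ ℓ
  D-bounded x with A x in Ax
  ... | true  = D₁-bounded x Ax
  ... | false = D₂-bounded x (subst (λ b → b ∨ B x ≡ true) Ax (A∪B x))
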